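{- Let $a$ and $b$ be positive integers. If $2^b + 1 \mid 3 \cdot 2^a + 1$, then $b = 2$. -}

module Defs where

{-# OPTIONS --safe #-}
-- Modulo d = 2^b + 1 we have 2^b ≡ -1, so stripping a factor 2^b from 3·2^a ± 1 flips the sign:
-- d divides 3·2^r + 1 or 3·2^r - 1 with r = a mod b. Both numbers are positive and below 2d,
-- so they equal d. The first case gives 3·2^r = 2^b, which is impossible; the second gives
-- 3·2^r = 2^b + 2, and after halving, 3·2^(r-1) = 2^(b-1) + 1 forces r = 1 and b = 2 by parity.
module Submission where

open import Defs
open import Data.Nat using (ℕ; _+_; _*_; _^_; _<_)
open import Data.Nat.Divisibility using (_∣_)
open import Relation.Binary.PropositionalEquality using (_≡_)

open import Data.Nat using (zero; suc; _∸_; _≤_; z≤n; s≤s; _%_; _/_; NonZero; >-nonZero)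
open import Data.Nat.Properties
open import Data.Nat.DivMod using (m≡m%n+[m/n]*n; m%n<n)
open import Data.Nat.Divisibility using (divides; ∣m+n∣m⇒∣n; n∣m*n)
open import Data.Nat.Tactic.RingSolver using (solve-∀)
open import Data.Sum using (_⊎_; inj₁; inj₂)
open import Data.Empty using (⊥-elim)
open import Relation.Nullary using (¬_)
open import Relation.Binary.PropositionalEquality
  using (_≢_; refl; sym; trans; cong; subst; module ≡-Reasoning)

n+1∣m*n+1⇒n+1∣m∸1 : ∀ m n → 0 < m → n + 1 ∣ m * n + 1 → n + 1 ∣ m ∸ 1
n+1∣m*n+1⇒n+1∣m∸1 (suc k) n _ d∣ =
  ∣m+n∣m⇒∣n (subst (n + 1 ∣_) (sym (sum≡ k n)) (n∣m*n (suc k))) d∣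
  where
  sum≡ : ∀ k n → suc k * n + 1 + k ≡ suc k * (n + 1)
  sum≡ = solve-∀

n+1∣m*n∸1⇒n+1∣m+1 : ∀ m n → 0 < m → 0 < n → n + 1 ∣ m * n ∸ 1 → n + 1 ∣ m + 1
n+1∣m*n∸1⇒n+1∣m+1 (suc k) (suc l) _ _ d∣ =
  ∣m+n∣m⇒∣n (subst (suc l + 1 ∣_) (sym (sum≡ k l)) (n∣m*n (suc k))) d∣
  where
  sum≡ : ∀ k l → l + k * suc l + (suc k + 1) ≡ suc k * (suc l + 1)
  sum≡ = solve-∀

0<3*2^n : ∀ n → 0 < 3 * 2 ^ n
0<3*2^n n = ≤-trans (m^n>0 2 n) (m≤m+n (2 ^ n) _)

3*2^[[1+q]*b+r]≡3*2^[q*b+r]*2^b : ∀ q b r → 3 * 2 ^ (suc q * b + r) ≡ 3 * 2 ^ (q * b + r) * 2 ^ b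
3*2^[[1+q]*b+r]≡3*2^[q*b+r]*2^b q b r = begin
  3 * 2 ^ ((b + q * b) + r)      ≡⟨ cong (λ e → 3 * 2 ^ e) (+-assoc b (q * b) r) ⟩
  3 * 2 ^ (b + (q * b + r))      ≡⟨ cong (3 *_) (^-distribˡ-+-* 2 b (q * b + r)) ⟩
  3 * (2 ^ b * 2 ^ (q * b + r))  ≡⟨ reassoc (2 ^ b) (2 ^ (q * b + r)) ⟩
  3 * 2 ^ (q * b + r) * 2 ^ b    ∎
  where
  open ≡-Reasoning
  reassoc : ∀ x y → 3 * (x * y) ≡ 3 * y * x
  reassoc = solve-∀

infix 4 _∣3*2^_±1

_∣3*2^_±1 : ℕ → ℕ → Set
d ∣3*2^ r ±1 = d ∣ 3 * 2 ^ r + 1 ⊎ d ∣ 3 * 2 ^ r ∸ 1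

module _ (b r : ℕ) where

  ∣3*2^[q*b+r]+1⇒∣3*2^r±1 : ∀ q →
    2 ^ b + 1 ∣ 3 * 2 ^ (q * b + r) + 1 → 2 ^ b + 1 ∣3*2^ r ±1
  ∣3*2^[q*b+r]∸1⇒∣3*2^r±1 : ∀ q →
    2 ^ b + 1 ∣ 3 * 2 ^ (q * b + r) ∸ 1 → 2 ^ b + 1 ∣3*2^ r ±1

  ∣3*2^[q*b+r]+1⇒∣3*2^r±1 zero    d∣ = inj₁ d∣
  ∣3*2^[q*b+r]+1⇒∣3*2^r±1 (suc q) d∣ =
    ∣3*2^[q*b+r]∸1⇒∣3*2^r±1 q (n+1∣m*n+1⇒n+1∣m∸1 _ (2 ^ b) (0<3*2^n (q * b + r))
      (subst (λ x → 2 ^ b + 1 ∣ x + 1) (3*2^[[1+q]*b+r]≡3*2^[q*b+r]*2^b q b r) d∣))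

  ∣3*2^[q*b+r]∸1⇒∣3*2^r±1 zero    d∣ = inj₂ d∣
  ∣3*2^[q*b+r]∸1⇒∣3*2^r±1 (suc q) d∣ =
    ∣3*2^[q*b+r]+1⇒∣3*2^r±1 q (n+1∣m*n∸1⇒n+1∣m+1 _ (2 ^ b) (0<3*2^n (q * b + r)) (m^n>0 2 b)
      (subst (λ x → 2 ^ b + 1 ∣ x ∸ 1) (3*2^[[1+q]*b+r]≡3*2^[q*b+r]*2^b q b r) d∣))

m∣n∧0<n<2*m⇒n≡m : ∀ {m n} → m ∣ n → 0 < n → n < 2 * m → n ≡ m
m∣n∧0<n<2*m⇒n≡m (divides zero          n≡0)   0<n _    = ⊥-elim (<-irrefl (sym n≡0) 0<n)
m∣n∧0<n<2*m⇒n≡m (divides (suc zero)    n≡m+0) _   _    = trans n≡m+0 (+-identityʳ _)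
m∣n∧0<n<2*m⇒n≡m {m} (divides (suc (suc q)) n≡[2+q]m) _ n<2m =
  ⊥-elim (≤⇒≯ (subst (2 * m ≤_) (sym n≡[2+q]m) (+-monoʳ-≤ m (+-monoʳ-≤ m z≤n))) n<2m)

3*2^[1+n]≡2*[3*2^n] : ∀ n → 3 * 2 ^ suc n ≡ 2 * (3 * 2 ^ n)
3*2^[1+n]≡2*[3*2^n] n = swap (2 ^ n)
  where
  swap : ∀ x → 3 * (2 * x) ≡ 2 * (3 * x)
  swap = solve-∀

3*2^m≢2^n : ∀ m n → 3 * 2 ^ m ≢ 2 ^ n
3*2^m≢2^n zero    zero    ()
3*2^m≢2^n zero    (suc n) eq = even≢odd (2 ^ n) 1 (sym eq)
3*2^m≢2^n (suc m) zero    eq = even≢odd (3 * 2 ^ m) 0 (trans (sym (3*2^[1+n]≡2*[3*2^n] m)) eq)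
3*2^m≢2^n (suc m) (suc n) eq =
  3*2^m≢2^n m n (*-cancelˡ-≡ _ _ 2 (trans (sym (3*2^[1+n]≡2*[3*2^n] m)) eq))

3*2^r+1<2*[2^b+1] : ∀ {r b} → r < b → 3 * 2 ^ r + 1 < 2 * (2 ^ b + 1)
3*2^r+1<2*[2^b+1] {r} {b} r<b = begin-strict
  3 * 2 ^ r + 1          ≤⟨ +-monoˡ-≤ 1 (*-monoˡ-≤ (2 ^ r) (n≤1+n 3)) ⟩
  4 * 2 ^ r + 1          ≡⟨ cong (_+ 1) (*-assoc 2 2 (2 ^ r)) ⟩
  2 * 2 ^ suc r + 1      ≤⟨ +-monoˡ-≤ 1 (*-monoʳ-≤ 2 (^-monoʳ-≤ 2 r<b)) ⟩
  2 * 2 ^ b + 1          <⟨ +-monoʳ-< (2 * 2 ^ b) (n<1+n 1) ⟩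
  2 * 2 ^ b + 2          ≡⟨ *-distribˡ-+ 2 (2 ^ b) 1 ⟨
  2 * (2 ^ b + 1)        ∎
  where open ≤-Reasoning

3*2^r≡2^b+1⇒b≡1 : ∀ {r b} → r < b → 3 * 2 ^ r ≡ 2 ^ b + 1 → b ≡ 1
3*2^r≡2^b+1⇒b≡1 {zero}  {suc b} _ eq
  with m^n≡1⇒n≡0∨m≡1 2 b (sym (*-cancelˡ-≡ 1 (2 ^ b) 2 (+-cancelʳ-≡ 1 2 (2 * 2 ^ b) eq)))
... | inj₁ refl = refl
3*2^r≡2^b+1⇒b≡1 {suc r} {suc b} _ eq =
  ⊥-elim (even≢odd (3 * 2 ^ r) (2 ^ b) (trans (sym (3*2^[1+n]≡2*[3*2^n] r)) (trans eq (+-comm _ 1))))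

3*2^r≡2^b+2⇒b≡2 : ∀ {r b} → r < b → 3 * 2 ^ r ≡ 2 ^ b + 2 → b ≡ 2
3*2^r≡2^b+2⇒b≡2 {zero}  {suc b} _ eq = ⊥-elim (even≢odd (2 ^ b) 0 (sym (+-cancelʳ-≡ 2 1 _ eq)))
3*2^r≡2^b+2⇒b≡2 {suc r} {suc b} (s≤s r<b) eq =
  cong suc (3*2^r≡2^b+1⇒b≡1 r<b (*-cancelˡ-≡ _ _ 2 halve))
  where
  open ≡-Reasoning
  halve : 2 * (3 * 2 ^ r) ≡ 2 * (2 ^ b + 1)
  halve = begin
    2 * (3 * 2 ^ r)  ≡⟨ 3*2^[1+n]≡2*[3*2^n] r ⟨
    3 * 2 ^ suc r    ≡⟨ eq ⟩
    2 * 2 ^ b + 2    ≡⟨ *-distribˡ-+ 2 (2 ^ b) 1 ⟨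
    2 * (2 ^ b + 1)  ∎

r<b⇒2^b+1∤3*2^r+1 : ∀ {r b} → r < b → ¬ 2 ^ b + 1 ∣ 3 * 2 ^ r + 1
r<b⇒2^b+1∤3*2^r+1 {r} {b} r<b d∣ =
  3*2^m≢2^n r b (+-cancelʳ-≡ 1 _ _ (m∣n∧0<n<2*m⇒n≡m d∣ (m≤n+m 1 _) (3*2^r+1<2*[2^b+1] r<b)))

r<b∧2^b+1∣3*2^r∸1⇒b≡2 : ∀ {r b} → r < b → 2 ^ b + 1 ∣ 3 * 2 ^ r ∸ 1 → b ≡ 2
r<b∧2^b+1∣3*2^r∸1⇒b≡2 {r} {b} r<b d∣ = 3*2^r≡2^b+2⇒b≡2 r<b (begin
  3 * 2 ^ r            ≡⟨ m∸n+n≡m (0<3*2^n r) ⟨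
  3 * 2 ^ r ∸ 1 + 1    ≡⟨ cong (_+ 1) (m∣n∧0<n<2*m⇒n≡m d∣ 0<3*2^r∸1 3*2^r∸1<2*[2^b+1]) ⟩
  2 ^ b + 1 + 1        ≡⟨ +-assoc (2 ^ b) 1 1 ⟩
  2 ^ b + 2            ∎)
  where
  open ≡-Reasoning
  0<3*2^r∸1 : 0 < 3 * 2 ^ r ∸ 1
  0<3*2^r∸1 = m<n⇒0<n∸m (≤-trans (s≤s (s≤s z≤n)) (*-monoʳ-≤ 3 (m^n>0 2 r)))
  3*2^r∸1<2*[2^b+1] : 3 * 2 ^ r ∸ 1 < 2 * (2 ^ b + 1)
  3*2^r∸1<2*[2^b+1] = ≤-<-trans (≤-trans (m∸n≤m _ 1) (m≤m+n _ 1)) (3*2^r+1<2*[2^b+1] r<b)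

r<b∧2^b+1∣3*2^r±1⇒b≡2 : ∀ {r b} → r < b → 2 ^ b + 1 ∣3*2^ r ±1 → b ≡ 2
r<b∧2^b+1∣3*2^r±1⇒b≡2 r<b (inj₁ d∣) = ⊥-elim (r<b⇒2^b+1∤3*2^r+1 r<b d∣)
r<b∧2^b+1∣3*2^r±1⇒b≡2 r<b (inj₂ d∣) = r<b∧2^b+1∣3*2^r∸1⇒b≡2 r<b d∣

2^b+1∣3*2^a+1⇒2^b+1∣3*2^[a%b]±1 : ∀ a b .{{_ : NonZero b}} →
  2 ^ b + 1 ∣ 3 * 2 ^ a + 1 → 2 ^ b + 1 ∣3*2^ a % b ±1
2^b+1∣3*2^a+1⇒2^b+1∣3*2^[a%b]±1 a b d∣ = ∣3*2^[q*b+r]+1⇒∣3*2^r±1 b (a % b) (a / b)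
  (subst (λ e → 2 ^ b + 1 ∣ 3 * 2 ^ e + 1) (trans (m≡m%n+[m/n]*n a b) (+-comm (a % b) _)) d∣)

lemma17 : (a b : ℕ) → 0 < a → 0 < b → 2 ^ b + 1 ∣ 3 * 2 ^ a + 1 → b ≡ 2
lemma17 a b _ 0<b d∣ =
  r<b∧2^b+1∣3*2^r±1⇒b≡2 (m%n<n a b) (2^b+1∣3*2^a+1⇒2^b+1∣3*2^[a%b]±1 a b d∣)
  where instance
  b≢0 : NonZero b
  b≢0 = >-nonZero 0<b
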